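{- Let $k\geq1$. Let $\mathcal{B}^{(k)}$ be the set of all $k$-box paths (of all sizes) and $\hat{\mathcal{D}}^{(k+1)}$ the set of all augmented $(k+1)$-Dyck paths (of all sizes, including the empty path). Then \[\mathcal{B}^{(k)}=\{\,\mu_{1}U\mu_{2}U\cdots\mu_{k+1}UD^{k}L:\ \mu_{1},\mu_{2},\dots,\mu_{k+1}\in\hat{\mathcal{D}}^{(k+1)}\,\},\] where juxtaposition denotes concatenation of words.
   Context: A skew Dyck path is a word $w$ over $\{U,D,L\}$ such that: $w$ contains neither $UL$ nor $LU$ as a contiguous subword; the number of $U$s equals the total number of $D$s and $L$s; and in every prefix the total number of $D$s and $L$s is at most the number of $U$s. Its semilength is its number of $U$s. A factor is a contiguous subword; $X^{m}$ denotes $m$ consecutive copies of $X$. For $k\geq1$, a $k$-box path of size $n$ is a skew Dyck path of semilength $(k+2)n-1$ containing exactly $n$ occurrences of the factor $UD^{k}L$. For $m\geq2$, an $m$-Dyck path of size $n$ is a lattice path with steps $(1,1)$ and $(m,-m)$ from $(0,0)$ to $(2mn,0)$ never going below the $x$-axis; an augmented $m$-Dyck path of size $n$ is the skew Dyck path obtained from an $m$-Dyck path of size $n$ by writing $(1,1)$ as $U$ and replacing each step $(m,-m)$ by the factor $UD^{m-1}LD$. Equivalently, augmented $m$-Dyck paths of size $n$ are exactly the skew Dyck paths of the form $U^{a_{1}}D^{m-1}LD\,U^{a_{2}}D^{m-1}LD\cdots U^{a_{n}}D^{m-1}LD$ with $a_{1},\dots,a_{n}$ positive integers (the empty path for $n=0$).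 -}

module Defs where

open import Data.Nat using (ℕ; zero; suc; _+_; _*_; _∸_; _≤_)
open import Data.List using (List; []; _∷_; _++_; replicate; length; filter; concat; map)
open import Data.List.Relation.Unary.All using (All)
open import Data.Bool using (Bool; true; false; _∧_; if_then_else_)
open import Data.Product using (Σ; _×_; ∃; ∃-syntax; _,_)
open import Data.Vec using (Vec; toList)
open import Relation.Binary.PropositionalEquality using (_≡_)
open import Relation.Nullary using (¬_)

data Step : Set where
  U D L : Step

Word : Set
Word = List Step

#U : Word → ℕ
#U [] = 0
#U (U ∷ w) = suc (#U w)
#U (D ∷ w) = #U w
#U (L ∷ w) = #U w

#DL : Word → ℕ
#DL [] = 0
#DL (U ∷ w) = #DL w
#DL (D ∷ w) = suc (#DL w)
#DL (L ∷ w) = suc (#DL w)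

Factor : Word → Word → Set
Factor x w = ∃[ p ] ∃[ q ] (w ≡ p ++ x ++ q)

record SkewDyck (w : Word) : Set where
  field
    noUL     : ¬ Factor (U ∷ L ∷ []) w
    noLU     : ¬ Factor (L ∷ U ∷ []) w
    balanced : #U w ≡ #DL w
    prefixes : ∀ p q → w ≡ p ++ q → #DL p ≤ #U p

semilength : Word → ℕ
semilength = #U

pow : Word → ℕ → Word
pow X zero = []
pow X (suc m) = X ++ pow X m

_==_ : Step → Step → Bool
U == U = true
D == D = true
L == L = true
_ == _ = false

startsWith : Word → Word → Bool
startsWith [] w = true
startsWith (a ∷ x) [] = false
startsWith (a ∷ x) (b ∷ w) = (a == b) ∧ startsWith x w

occ : Word → Word → ℕ
occ x [] = if startsWith x [] then 1 else 0
occ x (b ∷ w) = (if startsWith x (b ∷ w) then 1 else 0) + occ x w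

boxFactor : ℕ → Word
boxFactor k = U ∷ (replicate k D ++ L ∷ [])

IsBoxPathOfSize : ℕ → ℕ → Word → Set
IsBoxPathOfSize k n w =
  SkewDyck w × (semilength w + 1 ≡ (k + 2) * n) × (occ (boxFactor k) w ≡ n)

IsBoxPath : ℕ → Word → Set
IsBoxPath k w = ∃[ n ] IsBoxPathOfSize k n w

augBlock : ℕ → ℕ → Word
augBlock m a = replicate a U ++ replicate (m ∸ 1) D ++ L ∷ D ∷ []

IsAugDyckOfSize : ℕ → ℕ → Word → Set
IsAugDyckOfSize m n w =
  SkewDyck w ×
  (Σ (Vec ℕ n) λ as →
     All (λ a → 1 ≤ a) (toList as) × (w ≡ concat (map (augBlock m) (toList as))))

IsAugDyck : ℕ → Word → Set
IsAugDyck m w = ∃[ n ] IsAugDyckOfSize m n w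

interleaveU : List Word → Word
interleaveU [] = []
interleaveU (μ ∷ μs) = μ ++ U ∷ interleaveU μs

-- A skew Dyck path is a walk from height 0 to 0 that never goes below 0 and
-- has no factor UL or LU. Each occurrence of U Dᵏ L contains k + 1 of the
-- steps D, L, occurrences are disjoint, and since LU is forbidden each one is
-- followed by a further D or L unless it ends the word; hence
-- (k + 2) · #boxes ≤ #DL + 1, with equality exactly for the words
-- U^{a₁} Dᵏ L D ⋯ U^{aₙ} Dᵏ L (k ≥ 1 keeps UL out of a box). The size condition
-- of a k-box path is this equality. Such a walk is read from left to right while
-- keeping a stack μ₀ U μ₁ ⋯ U μₕ of augmented (k+1)-Dyck paths, h the current
-- height: an up step pushes the empty path, and a factor U Dᵏ L D merges the top
-- k + 1 entries into the one below, which is the grammar rule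
-- μ ↦ μ U ν₁ ⋯ U ν_{k+1} U Dᵏ L D of augmented (k+1)-Dyck paths. The final
-- U Dᵏ L is read at height k, when the stack holds exactly k + 1 paths.

module Submission where

open import Defs
open import Data.Bool using (true; false; if_then_else_)
open import Data.Bool.Properties using (∧-conicalˡ; ∧-conicalʳ)
open import Data.Empty using (⊥; ⊥-elim)
open import Data.List using ([]; _∷_; _++_; replicate; length; concat; map)
open import Data.List.Properties using (++-assoc; ++-identityʳ; ∷-injectiveʳ; length-++-≤ʳ)
open import Data.List.Relation.Unary.All using (All; []; _∷_)
import Data.List.Relation.Unary.All as All
open import Data.List.Relation.Unary.All.Properties using (++⁺)
open import Data.List.Relation.Unary.Linked using (Linked; []; [-]; _∷_)
import Data.List.Relation.Unary.Linked as Linked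
open import Data.Nat using (ℕ; zero; suc; _+_; _*_; _≤_; z≤n; s≤s)
open import Data.Nat.Properties
open import Data.Product using (Σ; _×_; _,_; proj₁; proj₂; ∃-syntax)
open import Data.Sum using (_⊎_; inj₁; inj₂)
open import Data.Unit using (⊤; tt)
open import Data.Vec using (Vec; toList; _∷ʳ_)
import Data.Vec as Vec
open import Data.Vec.Properties using (toList-∷ʳ; length-toList)
open import Function using (_∘_)
open import Function.Bundles using (_⇔_; mk⇔; Equivalence)
open import Function.Properties.Equivalence using () renaming (sym to ⇔-sym; trans to ⇔-trans)
open import Relation.Binary.PropositionalEquality
open import Relation.Nullary using (¬_)

data Walk : ℕ → Word → ℕ → Set where
  []   : ∀ {h} → Walk h [] h
  up   : ∀ {h w h'} → Walk (suc h) w h' → Walk h (U ∷ w) h'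
  down : ∀ {h w h'} → Walk h w h' → Walk (suc h) (D ∷ w) h'
  left : ∀ {h w h'} → Walk h w h' → Walk (suc h) (L ∷ w) h'

walk-++ : ∀ {h m h' x y} → Walk h x m → Walk m y h' → Walk h (x ++ y) h'
walk-++ []       q = q
walk-++ (up p)   q = up (walk-++ p q)
walk-++ (down p) q = down (walk-++ p q)
walk-++ (left p) q = left (walk-++ p q)

walk-split : ∀ x {y h h'} → Walk h (x ++ y) h' → ∃[ m ] Walk h x m × Walk m y h'
walk-split []      p        = _ , [] , p
walk-split (U ∷ x) (up p)   with walk-split x p
... | m , p₁ , p₂ = m , up p₁ , p₂
walk-split (D ∷ x) (down p) with walk-split x p
... | m , p₁ , p₂ = m , down p₁ , p₂
walk-split (L ∷ x) (left p) with walk-split x p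
... | m , p₁ , p₂ = m , left p₁ , p₂

walk-suc : ∀ {h w h'} → Walk h w h' → Walk (suc h) w (suc h')
walk-suc []       = []
walk-suc (up p)   = up (walk-suc p)
walk-suc (down p) = down (walk-suc p)
walk-suc (left p) = left (walk-suc p)

walk-lift : ∀ {w} → Walk 0 w 0 → ∀ h → Walk h w h
walk-lift p zero    = p
walk-lift p (suc h) = walk-suc (walk-lift p h)

walk-box : ∀ j {h v h'} → Walk h v h' → Walk (suc (j + h)) (replicate j D ++ L ∷ v) h'
walk-box zero    p = left p
walk-box (suc j) p = down (walk-box j p)

walk-box⁻¹ : ∀ j {h v h'} → Walk h (replicate j D ++ L ∷ v) h' →
             ∃[ m ] h ≡ suc (j + m) × Walk m v h'
walk-box⁻¹ zero    (left p) = _ , refl , p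
walk-box⁻¹ (suc j) (down p) with walk-box⁻¹ j p
... | m , refl , q = m , refl , q

walk-balance : ∀ {h w h'} → Walk h w h' → h + #U w ≡ h' + #DL w
walk-balance {h}       []               = refl
walk-balance {h}       (up {w = w} p)   = trans (+-suc h (#U w)) (walk-balance p)
walk-balance {h' = h'} (down {w = w} p) = trans (cong suc (walk-balance p)) (sym (+-suc h' (#DL w)))
walk-balance {h' = h'} (left {w = w} p) = trans (cong suc (walk-balance p)) (sym (+-suc h' (#DL w)))

PrefixBounded : ℕ → Word → Set
PrefixBounded h w = ∀ p q → w ≡ p ++ q → #DL p ≤ h + #U p

walk⇒prefixBounded : ∀ {h w h'} → Walk h w h' → PrefixBounded h w
walk⇒prefixBounded p x _ refl with walk-split x p
... | m , px , _ = subst (#DL x ≤_) (sym (walk-balance px)) (m≤n+m (#DL x) m)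

prefixBounded⇒walk : ∀ h w h' → PrefixBounded h w → h + #U w ≡ h' + #DL w → Walk h w h'
prefixBounded⇒walk h [] h' _ e =
  subst (Walk h []) (trans (sym (+-identityʳ h)) (trans e (+-identityʳ h'))) []
prefixBounded⇒walk h (U ∷ w) h' bd e =
  up (prefixBounded⇒walk (suc h) w h'
       (λ p q eq → subst (#DL p ≤_) (+-suc h (#U p)) (bd (U ∷ p) q (cong (U ∷_) eq)))
       (trans (sym (+-suc h (#U w))) e))
prefixBounded⇒walk zero (D ∷ w) h' bd e with bd (D ∷ []) w refl
... | ()
prefixBounded⇒walk (suc h) (D ∷ w) h' bd e =
  down (prefixBounded⇒walk h w h' (λ p q eq → ≤-pred (bd (D ∷ p) q (cong (D ∷_) eq)))
         (suc-injective (trans e (+-suc h' (#DL w)))))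
prefixBounded⇒walk zero (L ∷ w) h' bd e with bd (L ∷ []) w refl
... | ()
prefixBounded⇒walk (suc h) (L ∷ w) h' bd e =
  left (prefixBounded⇒walk h w h' (λ p q eq → ≤-pred (bd (L ∷ p) q (cong (L ∷_) eq)))
         (suc-injective (trans e (+-suc h' (#DL w)))))

-- Skew Dyck paths as walks

Compatible : Step → Step → Set
Compatible U L = ⊥
Compatible L U = ⊥
Compatible _ _ = ⊤

linked⇒noFactor : ∀ {a b} → ¬ Compatible a b →
                  ∀ {w} → Linked Compatible w → ¬ Factor (a ∷ b ∷ []) w
linked⇒noFactor ¬ab (ab ∷ _) ([] , _ , refl) = ¬ab ab
linked⇒noFactor ¬ab [] ([] , _ , ())
linked⇒noFactor ¬ab [] (_ ∷ _ , _ , ())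
linked⇒noFactor ¬ab {_ ∷ _} lw (_ ∷ p , q , eq) =
  linked⇒noFactor ¬ab (Linked.tail lw) (p , q , ∷-injectiveʳ eq)

walk⇒skewDyck : ∀ {w} → Linked Compatible w → Walk 0 w 0 → SkewDyck w
walk⇒skewDyck lw p = record
  { noUL     = linked⇒noFactor (λ ()) lw
  ; noLU     = linked⇒noFactor (λ ()) lw
  ; balanced = walk-balance p
  ; prefixes = walk⇒prefixBounded p
  }

skewDyck⇒walk : ∀ {w} → SkewDyck w → Walk 0 w 0
skewDyck⇒walk {w} s = prefixBounded⇒walk 0 w 0 (SkewDyck.prefixes s) (SkewDyck.balanced s)

==-sound : ∀ a b → (a == b) ≡ true → a ≡ b
==-sound U U _ = refl
==-sound D D _ = refl
==-sound L L _ = refl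
==-sound U D ()
==-sound U L ()
==-sound D U ()
==-sound D L ()
==-sound L U ()
==-sound L D ()

startsWith-sound : ∀ x w → startsWith x w ≡ true → ∃[ v ] w ≡ x ++ v
startsWith-sound []      w       _ = w , refl
startsWith-sound (a ∷ x) (b ∷ w) e with ==-sound a b (∧-conicalˡ _ _ e)
... | refl with startsWith-sound x w (∧-conicalʳ _ _ e)
...   | v , refl = v , refl

factor-++ : ∀ p {x w} → Factor x w → Factor x (p ++ w)
factor-++ p {x} (q , r , refl) = p ++ q , r , sym (++-assoc p q (x ++ r))

NoLU : Word → Set
NoLU w = ¬ Factor (L ∷ U ∷ []) w

interleaveU-snoc : ∀ l μ → interleaveU (l ++ μ ∷ []) ≡ interleaveU l ++ μ ++ U ∷ []
interleaveU-snoc []      μ = refl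
interleaveU-snoc (ν ∷ l) μ =
  trans (cong (λ z → ν ++ U ∷ z) (interleaveU-snoc l μ))
        (sym (++-assoc ν (U ∷ interleaveU l) (μ ++ U ∷ [])))

Tight : ℕ → ℕ → Set → Set
Tight x y P = x ≤ y × (x ≡ y → P)

tight-suc : ∀ {x y P Q} → Tight x y P → Tight x (suc y) Q
tight-suc (x≤y , _) =
  m≤n⇒m≤1+n x≤y , λ x≡1+y → ⊥-elim (1+n≰n (subst (_≤ _) x≡1+y x≤y))

tight-+ : ∀ a {x y P} → Tight x y P → Tight (a + x) (a + y) P
tight-+ a (x≤y , x≡y→P) = +-monoʳ-≤ a x≤y , x≡y→P ∘ +-cancelˡ-≡ a _ _

tight-map : ∀ {x y} {P Q : Set} → (P → Q) → Tight x y P → Tight x y Q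
tight-map f (x≤y , x≡y→P) = x≤y , f ∘ x≡y→P

tight-cong : ∀ {x x' y y' P} → x ≡ x' → y ≡ y' → Tight x' y' P → Tight x y P
tight-cong refl refl t = t

module BoxPaths (k-1 : ℕ) where

  k : ℕ
  k = suc k-1

  boxLength : ℕ
  boxLength = suc (suc k)

  UDᵏL : Word
  UDᵏL = boxFactor k

  DᵏL : Word
  DᵏL = replicate k D ++ L ∷ []

  DᵏLD : Word
  DᵏLD = replicate k D ++ L ∷ D ∷ []

  -- Counting boxes

  data BoxShaped : Word → Set where
    rise  : ∀ {w} → BoxShaped w → BoxShaped (U ∷ w)
    final : BoxShaped (U ∷ replicate k D ++ L ∷ [])
    box   : ∀ {w} → BoxShaped w → BoxShaped (U ∷ replicate k D ++ L ∷ D ∷ w)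

  boxShaped-head : ∀ {w} → BoxShaped w → ∃[ r ] w ≡ U ∷ r
  boxShaped-head (rise _) = _ , refl
  boxShaped-head final    = _ , refl
  boxShaped-head (box _)  = _ , refl

  occ-downs : ∀ j v → occ UDᵏL (replicate j D ++ v) ≡ occ UDᵏL v
  occ-downs zero    v = refl
  occ-downs (suc j) v = occ-downs j v

  startsWith-downsL : ∀ j v → startsWith (replicate j D ++ L ∷ []) (replicate j D ++ L ∷ v) ≡ true
  startsWith-downsL zero    v = refl
  startsWith-downsL (suc j) v = startsWith-downsL j v

  #DL-downs : ∀ j v → #DL (replicate j D ++ v) ≡ j + #DL v
  #DL-downs zero    v = refl
  #DL-downs (suc j) v = cong suc (#DL-downs j v)

  occ-box : ∀ v → occ UDᵏL (U ∷ replicate k D ++ L ∷ v) * boxLength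
                ≡ boxLength + occ UDᵏL v * boxLength
  occ-box v =
    trans (cong (λ b → ((if b then 1 else 0) + occ UDᵏL (replicate k D ++ L ∷ v)) * boxLength)
                (startsWith-downsL k v))
          (cong (λ o → suc o * boxLength) (occ-downs k (L ∷ v)))

  #DL-box : ∀ v → suc (#DL (U ∷ replicate k D ++ L ∷ v)) ≡ boxLength + #DL v
  #DL-box v = cong suc (trans (#DL-downs k (L ∷ v)) (+-suc k (#DL v)))

  boxAhead : ∀ w → (∃[ v ] w ≡ replicate k D ++ L ∷ v) ⊎ occ UDᵏL (U ∷ w) ≡ occ UDᵏL w
  boxAhead w with startsWith DᵏL w in e
  ... | false = inj₂ refl
  ... | true with startsWith-sound DᵏL w e
  ...   | v , refl = inj₁ (v , ++-assoc (replicate k D) (L ∷ []) v)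

  OccBound : Word → Set
  OccBound w = Tight (occ UDᵏL w * boxLength) (suc (#DL w)) (BoxShaped w)

  -- The fuel n bounds the length: after a box the recursion continues on a
  -- suffix that is not a structural subterm of the word.
  occ-bound     : ∀ n w → length w ≤ n → NoLU w → OccBound w
  occ-bound-box : ∀ n v → length v ≤ n → NoLU (U ∷ replicate k D ++ L ∷ v) →
                  OccBound (U ∷ replicate k D ++ L ∷ v)

  occ-bound _       []      _       _  = z≤n , λ ()
  occ-bound (suc n) (D ∷ w) (s≤s l) nl = tight-suc (occ-bound n w l (nl ∘ factor-++ (D ∷ [])))
  occ-bound (suc n) (L ∷ w) (s≤s l) nl = tight-suc (occ-bound n w l (nl ∘ factor-++ (L ∷ [])))
  occ-bound (suc n) (U ∷ w) (s≤s l) nl with boxAhead w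
  ... | inj₁ (v , refl) =
    occ-bound-box n v (≤-trans (n≤1+n _) (≤-trans (length-++-≤ʳ (L ∷ v) {replicate k D}) l)) nl
  ... | inj₂ e =
    tight-cong (cong (_* boxLength) e) refl (tight-map rise (occ-bound n w l (nl ∘ factor-++ (U ∷ []))))

  occ-bound-box _       []      _       _  = tight-cong (occ-box []) (#DL-box []) (≤-refl , λ _ → final)
  occ-bound-box _       (U ∷ v) _       nl = ⊥-elim (nl (U ∷ replicate k D , v , refl))
  occ-bound-box (suc n) (D ∷ v) (s≤s l) nl =
    tight-cong (occ-box (D ∷ v)) (#DL-box (D ∷ v)) (tight-+ boxLength (tight-map box
      (occ-bound n v l (nl ∘ factor-++ (U ∷ replicate k D) ∘ factor-++ (L ∷ D ∷ [])))))
  occ-bound-box (suc n) (L ∷ v) (s≤s l) nl =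
    tight-cong (occ-box (L ∷ v)) (#DL-box (L ∷ v)) (tight-+ boxLength (tight-map LU-contradiction
      (occ-bound n v l (nl ∘ factor-++ (U ∷ replicate k D) ∘ factor-++ (L ∷ L ∷ [])))))
    where
    LU-contradiction : BoxShaped v → BoxShaped (U ∷ replicate k D ++ L ∷ L ∷ v)
    LU-contradiction s with boxShaped-head s
    ... | r , refl = ⊥-elim (nl (factor-++ (U ∷ replicate k D) (factor-++ (L ∷ []) ([] , r , refl))))

  count⇒boxShaped : ∀ {w} → NoLU w → occ UDᵏL w * boxLength ≡ suc (#DL w) → BoxShaped w
  count⇒boxShaped {w} nl = proj₂ (occ-bound (length w) w ≤-refl nl)

  boxShaped⇒count : ∀ {w} → BoxShaped w → occ UDᵏL w * boxLength ≡ suc (#DL w)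
  boxShaped⇒count (rise s) with boxShaped-head s
  ... | _ , refl = boxShaped⇒count s
  boxShaped⇒count final = trans (occ-box []) (sym (#DL-box []))
  boxShaped⇒count (box {w} s) =
    trans (occ-box (D ∷ w)) (trans (cong (boxLength +_) (boxShaped⇒count s)) (sym (#DL-box (D ∷ w))))

  box-size : ∀ n → (k + 2) * n ≡ n * boxLength
  box-size n = trans (cong (_* n) (+-comm k 2)) (*-comm boxLength n)

  semilength+1 : ∀ {w} → SkewDyck w → #U w + 1 ≡ suc (#DL w)
  semilength+1 {w} sk = trans (+-comm (#U w) 1) (cong suc (SkewDyck.balanced sk))

  isBoxPath⇔ : ∀ {w} → IsBoxPath k w ⇔ (SkewDyck w × BoxShaped w)
  isBoxPath⇔ {w} = mk⇔ to from
    where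
    to : IsBoxPath k w → SkewDyck w × BoxShaped w
    to (n , sk , size , refl) = sk , count⇒boxShaped (SkewDyck.noLU sk) count
      where
      open ≡-Reasoning
      count : occ UDᵏL w * boxLength ≡ suc (#DL w)
      count = begin
        occ UDᵏL w * boxLength ≡⟨ box-size (occ UDᵏL w) ⟨
        (k + 2) * occ UDᵏL w   ≡⟨ size ⟨
        #U w + 1               ≡⟨ semilength+1 sk ⟩
        suc (#DL w)            ∎
    from : SkewDyck w × BoxShaped w → IsBoxPath k w
    from (sk , s) =
      occ UDᵏL w , sk ,
      trans (semilength+1 sk) (trans (sym (boxShaped⇒count s)) (sym (box-size _))) , refl

  linked-downsL : ∀ j {v} → Linked Compatible (L ∷ v) →
                  Linked Compatible (D ∷ replicate j D ++ L ∷ v)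
  linked-downsL zero    lv = tt ∷ lv
  linked-downsL (suc j) lv = tt ∷ linked-downsL j lv

  linked-boxShaped : ∀ {s w} → Compatible s U → BoxShaped w → Linked Compatible (s ∷ w)
  linked-boxShaped su (rise w) = su ∷ linked-boxShaped tt w
  linked-boxShaped su final    = su ∷ tt ∷ linked-downsL k-1 [-]
  linked-boxShaped su (box w)  = su ∷ tt ∷ linked-downsL k-1 (tt ∷ linked-boxShaped tt w)

  skewDyck⇔walk : ∀ {w} → (SkewDyck w × BoxShaped w) ⇔ (Walk 0 w 0 × BoxShaped w)
  skewDyck⇔walk = mk⇔ (λ (sk , s) → skewDyck⇒walk sk , s)
                      (λ (p , s) → walk⇒skewDyck (Linked.tail (linked-boxShaped {U} tt s)) p , s)

  -- Blocks and augmented Dyck paths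

  data Blocks : Word → Set where
    []    : Blocks []
    block : ∀ a {v} → Blocks v → Blocks (U ∷ replicate a U ++ replicate k D ++ L ∷ D ∷ v)

  block-++ : ∀ a v y → (U ∷ replicate a U ++ replicate k D ++ L ∷ D ∷ v) ++ y
                     ≡ U ∷ replicate a U ++ replicate k D ++ L ∷ D ∷ v ++ y
  block-++ a v y =
    cong (U ∷_) (trans (++-assoc (replicate a U) _ y)
                       (cong (replicate a U ++_) (++-assoc (replicate k D) (L ∷ D ∷ v) y)))

  blocks-++ : ∀ {x y} → Blocks x → Blocks y → Blocks (x ++ y)
  blocks-++                []               by = by
  blocks-++ {y = y} (block a {v} bx) by = subst Blocks (sym (block-++ a v y)) (block a (blocks-++ bx by))

  blocks-rise : ∀ {z} → Blocks (U ∷ z) → Blocks (U ∷ U ∷ z)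
  blocks-rise (block a b) = block (suc a) b

  blocks-U : ∀ {x y} → Blocks x → Blocks (U ∷ y) → Blocks (U ∷ x ++ U ∷ y)
  blocks-U []           by = blocks-rise by
  blocks-U (block a bx) by = blocks-rise (blocks-++ (block a bx) by)

  concat⇒blocks : ∀ {n} (as : Vec ℕ n) → All (λ a → 1 ≤ a) (toList as) →
                  Blocks (concat (map (augBlock (suc k)) (toList as)))
  concat⇒blocks Vec.[]           []        = []
  concat⇒blocks (suc a Vec.∷ as) (_ ∷ pos) =
    subst Blocks (sym (block-++ a [] _)) (block a (concat⇒blocks as pos))

  blocks⇒concat : ∀ {v} → Blocks v → ∃[ n ] Σ (Vec ℕ n) λ as →
                  All (λ a → 1 ≤ a) (toList as) × v ≡ concat (map (augBlock (suc k)) (toList as))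
  blocks⇒concat [] = 0 , Vec.[] , [] , refl
  blocks⇒concat (block a {v} b) with blocks⇒concat b
  ... | n , as , pos , refl = suc n , suc a Vec.∷ as , s≤s z≤n ∷ pos , sym (block-++ a [] v)

  linked-ups : ∀ a {v} → Linked Compatible (U ∷ v) → Linked Compatible (U ∷ replicate a U ++ v)
  linked-ups zero    lv = lv
  linked-ups (suc a) lv = tt ∷ linked-ups a lv

  linked-blocks : ∀ {s v} → Compatible s U → Blocks v → Linked Compatible (s ∷ v)
  linked-blocks su []          = [-]
  linked-blocks su (block a b) = su ∷ linked-ups a (tt ∷ linked-downsL k-1 (tt ∷ linked-blocks tt b))

  AugDyck : Word → Set
  AugDyck μ = Blocks μ × Walk 0 μ 0

  augDyck⇔ : ∀ {μ} → IsAugDyck (suc k) μ ⇔ AugDyck μ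
  augDyck⇔ {μ} = mk⇔ to from
    where
    to : IsAugDyck (suc k) μ → AugDyck μ
    to (_ , sk , as , pos , refl) = concat⇒blocks as pos , skewDyck⇒walk sk
    from : AugDyck μ → IsAugDyck (suc k) μ
    from (b , p) with blocks⇒concat b
    ... | n , as , pos , eq = n , walk⇒skewDyck (Linked.tail (linked-blocks {U} tt b)) p , as , pos , eq

  augDyck-[] : AugDyck []
  augDyck-[] = [] , []

  data Ladder : ℕ → Word → Set where
    []  : Ladder 0 []
    _▷_ : ∀ {m t ν} → Ladder m t → AugDyck ν → Ladder (suc m) (t ++ U ∷ ν)

  data Stack : ℕ → Word → Set where
    [_] : ∀ {μ} → AugDyck μ → Stack 0 μ
    _▷_ : ∀ {h x μ} → Stack h x → AugDyck μ → Stack (suc h) (x ++ U ∷ μ)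

  ladder-blocks : ∀ {m t s} → Ladder m t → Blocks (U ∷ s) → Blocks (t ++ U ∷ s)
  ladder-blocks                []                 b = b
  ladder-blocks {s = s} (_▷_ {t = t} {ν} lt (bν , _)) b =
    subst Blocks (sym (++-assoc t (U ∷ ν) (U ∷ s))) (ladder-blocks lt (blocks-U bν b))

  ladder-walk : ∀ {m t} → Ladder m t → Walk 0 t m
  ladder-walk []                   = []
  ladder-walk (_▷_ {m} lt (_ , p)) = walk-++ (ladder-walk lt) (up (walk-lift p (suc m)))

  walk-DᵏLD : Walk (suc (suc k)) DᵏLD 0
  walk-DᵏLD = subst (λ h → Walk (suc h) DᵏLD 0) (+-comm k 1) (walk-box k (down []))

  augDyck-step : ∀ {t μ} → Ladder (suc k) t → AugDyck μ → AugDyck (μ ++ t ++ U ∷ DᵏLD)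
  augDyck-step lt (bμ , pμ) =
    blocks-++ bμ (ladder-blocks lt (block 0 [])) ,
    walk-++ pμ (walk-++ (ladder-walk lt) (up walk-DᵏLD))

  stack-split : ∀ m {j x} → Stack (m + j) x → ∃[ y ] ∃[ t ] x ≡ y ++ t × Stack j y × Ladder m t
  stack-split zero    {x = x} st = x , [] , sym (++-identityʳ x) , st , []
  stack-split (suc m) (_▷_ {μ = μ} st d) with stack-split m st
  ... | y , t , refl , st' , lt = y , t ++ U ∷ μ , ++-assoc y t (U ∷ μ) , st' , lt ▷ d

  stack-extend : ∀ {t} → (∀ {μ} → AugDyck μ → AugDyck (μ ++ t)) →
                 ∀ {j x} → Stack j x → Stack j (x ++ t)
  stack-extend     f [ d ]                  = [ f d ]
  stack-extend {t} f (_▷_ {x = x} {μ} st d) = subst (Stack _) (sym (++-assoc x (U ∷ μ) t)) (st ▷ f d)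

  stack-interleave : ∀ {h x} → Stack h x → Σ (Vec Word (suc h)) λ μs →
                     All AugDyck (toList μs) × x ++ U ∷ [] ≡ interleaveU (toList μs)
  stack-interleave [ d ] = _ Vec.∷ Vec.[] , d ∷ [] , refl
  stack-interleave (_▷_ {x = x} {μ} st d) with stack-interleave st
  ... | μs , ds , eq =
    μs ∷ʳ μ , subst (All AugDyck) (sym (toList-∷ʳ μ μs)) (++⁺ ds (d ∷ [])) , eq'
    where
    open ≡-Reasoning
    eq' : (x ++ U ∷ μ) ++ U ∷ [] ≡ interleaveU (toList (μs ∷ʳ μ))
    eq' = begin
      (x ++ U ∷ μ) ++ U ∷ []                 ≡⟨ ++-assoc x (U ∷ μ) (U ∷ []) ⟩
      x ++ U ∷ μ ++ U ∷ []                   ≡⟨ ++-assoc x (U ∷ []) (μ ++ U ∷ []) ⟨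
      (x ++ U ∷ []) ++ μ ++ U ∷ []           ≡⟨ cong (_++ μ ++ U ∷ []) eq ⟩
      interleaveU (toList μs) ++ μ ++ U ∷ [] ≡⟨ interleaveU-snoc (toList μs) μ ⟨
      interleaveU (toList μs ++ μ ∷ [])      ≡⟨ cong interleaveU (toList-∷ʳ μ μs) ⟨
      interleaveU (toList (μs ∷ʳ μ))         ∎

  Decomposition : (Word → Set) → Word → Set
  Decomposition P w =
    Σ (Vec Word (suc k)) λ μs → All P (toList μs) × w ≡ interleaveU (toList μs) ++ DᵏL

  decomposition-cong : ∀ {P Q : Word → Set} → (∀ {μ} → P μ ⇔ Q μ) → ∀ {w} →
                       Decomposition P w ⇔ Decomposition Q w
  decomposition-cong P⇔Q = mk⇔ (λ (μs , ps , eq) → μs , All.map (Equivalence.to P⇔Q) ps , eq)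
                               (λ (μs , qs , eq) → μs , All.map (Equivalence.from P⇔Q) qs , eq)

  parse : ∀ {h x w} → Stack h x → BoxShaped w → Walk h w 0 → Decomposition AugDyck (x ++ w)
  parse {x = x} st (rise {w} s) (up p) =
    subst (Decomposition AugDyck) (++-assoc x (U ∷ []) w) (parse (st ▷ augDyck-[]) s p)
  parse {x = x} st final (up p) with walk-box⁻¹ k p
  ... | _ , refl , [] with stack-interleave (subst (λ h → Stack h x) (+-identityʳ k) st)
  ...   | μs , ds , eq = μs , ds , trans (sym (++-assoc x (U ∷ []) DᵏL)) (cong (_++ DᵏL) eq)
  parse {x = x} st (box {w} s) (up p) with walk-box⁻¹ k p
  ... | _ , refl , down {h} q with stack-split (suc k) (subst (λ h → Stack h x) (+-suc k h) st)
  ...   | y , t , refl , st' , lt =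
    subst (Decomposition AugDyck) reassoc (parse (stack-extend (augDyck-step lt) st') s q)
    where
    open ≡-Reasoning
    reassoc : (y ++ t ++ U ∷ DᵏLD) ++ w ≡ (y ++ t) ++ U ∷ replicate k D ++ L ∷ D ∷ w
    reassoc = begin
      (y ++ t ++ U ∷ DᵏLD) ++ w                  ≡⟨ ++-assoc y _ w ⟩
      y ++ (t ++ U ∷ DᵏLD) ++ w                  ≡⟨ cong (y ++_) (++-assoc t (U ∷ DᵏLD) w) ⟩
      y ++ t ++ U ∷ DᵏLD ++ w                    ≡⟨ cong (λ z → y ++ t ++ U ∷ z)
                                                         (++-assoc (replicate k D) (L ∷ D ∷ []) w) ⟩
      y ++ t ++ U ∷ replicate k D ++ L ∷ D ∷ w   ≡⟨ ++-assoc y t _ ⟨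
      (y ++ t) ++ U ∷ replicate k D ++ L ∷ D ∷ w ∎

  walk-interleave : ∀ {μs} → All AugDyck μs → Walk 0 (interleaveU μs) (length μs)
  walk-interleave []             = []
  walk-interleave ((_ , p) ∷ ds) = walk-++ p (up (walk-suc (walk-interleave ds)))

  walk-DᵏL : Walk (suc k) DᵏL 0
  walk-DᵏL = subst (λ h → Walk (suc h) DᵏL 0) (+-identityʳ k) (walk-box k [])

  boxShaped-rises : ∀ a {w} → BoxShaped (U ∷ w) → BoxShaped (U ∷ replicate a U ++ w)
  boxShaped-rises zero    s = s
  boxShaped-rises (suc a) s = rise (boxShaped-rises a s)

  boxShaped-++ : ∀ {x y} → Blocks x → BoxShaped y → BoxShaped (x ++ y)
  boxShaped-++                []               s = s
  boxShaped-++ {y = y} (block a {v} b) s =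
    subst BoxShaped (sym (block-++ a v y)) (boxShaped-rises a (box (boxShaped-++ b s)))

  boxShaped-interleave : ∀ {μ μs} → All Blocks (μ ∷ μs) →
                         BoxShaped (interleaveU (μ ∷ μs) ++ DᵏL)
  boxShaped-interleave {μ} {μs} (b ∷ bs) =
    subst BoxShaped (sym (++-assoc μ (U ∷ interleaveU μs) DᵏL)) (boxShaped-++ b (rest bs))
    where
    rest : All Blocks μs → BoxShaped (U ∷ interleaveU μs ++ DᵏL)
    rest []         = final
    rest bs@(_ ∷ _) = rise (boxShaped-interleave bs)

  walk⇔decomposition : ∀ {w} → (Walk 0 w 0 × BoxShaped w) ⇔ Decomposition AugDyck w
  walk⇔decomposition = mk⇔ (λ (p , s) → parse [ augDyck-[] ] s p) compose
    where
    compose : ∀ {w} → Decomposition AugDyck w → Walk 0 w 0 × BoxShaped w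
    compose (μs@(_ Vec.∷ _) , ds , refl) =
      walk-++ (subst (Walk 0 _) (length-toList μs) (walk-interleave ds)) walk-DᵏL ,
      boxShaped-interleave (All.map proj₁ ds)

lemma3p4 : (k : ℕ) → 1 ≤ k → (w : Word) →
    IsBoxPath k w ⇔
      Σ (Vec Word (suc k)) (λ μs →
        All (IsAugDyck (suc k)) (toList μs) ×
        (w ≡ interleaveU (toList μs) ++ replicate k D ++ L ∷ []))
lemma3p4 (suc k-1) (s≤s z≤n) w =
  ⇔-trans isBoxPath⇔ (⇔-trans skewDyck⇔walk (⇔-trans walk⇔decomposition
    (decomposition-cong (⇔-sym augDyck⇔))))
  where open BoxPaths k-1
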